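{- Let $f:\mathbb{N}\to\mathbb{N}$ be increasing with $f(0)>0$. Let $\tau$ be a nonempty type, $k=\min\tau$, $l\in\tau$ and $t\in\mathbb{N}$. Then $M_{\tau_{\langle l,t\rangle}}(t+1)\le M_{\tau_{\langle k,t\rangle}}(t+1)$, and hence $M_\emptyset(t)=0$ and $M_\tau(t)=1+M_{\tau_{\langle\min\tau,t\rangle}}(t+1)$ for $\tau\ne\emptyset$.
   Context: A type is a finite multiset of natural numbers; types are added, subtracted and scaled as multisets ($p\times\tau$ multiplies every multiplicity by $p$). Let $N_k(t)=k\cdot(f(t)-1)$ and, for $k\in\tau$, $\tau_{\langle k,t\rangle}=\tau-\{k\}+N_k(t)\times\{k-1\}$ (for $k=0$, simply $\tau-\{0\}$). Since $\tau_{\langle k,t\rangle}$ is strictly smaller than $\tau$ in the (well-founded) multiset ordering, the following recursion defines a function $M_\tau:\mathbb{N}\to\mathbb{N}$ for every type $\tau$: $M_\tau(t)=\max_{k\in\tau}\{1+M_{\tau_{\langle k,t\rangle}}(t+1)\}$, with $\max\emptyset=0$. -}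

module Defs where

open import Data.Nat using (ℕ; zero; suc; _+_; _*_; _∸_; _⊔_; _<_; _≤_; z≤n; s≤s; pred)
open import Data.List using (List; []; _∷_)
open import Data.Product using (Σ; _×_; _,_)
open import Relation.Binary.PropositionalEquality using (_≡_; refl)
open import Relation.Nullary using (¬_)
open import Induction.WellFounded using (Acc; acc)

-- A type (finite multiset of naturals) is represented by its multiplicity
-- list: the i-th entry (0-indexed) is the multiplicity of i; entries beyond
-- the end of the list are 0.
Type : Set
Type = List ℕ

count : Type → ℕ → ℕ
count []       k       = 0
count (c ∷ cs) zero    = c
count (c ∷ cs) (suc k) = count cs k

_∈ᵀ_ : ℕ → Type → Set
k ∈ᵀ τ = 0 < count τ k

IsEmpty : Type → Set
IsEmpty τ = ∀ k → ¬ (k ∈ᵀ τ)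

IsMin : ℕ → Type → Set
IsMin k τ = k ∈ᵀ τ × (∀ j → j ∈ᵀ τ → k ≤ j)

-- red τ k n = τ - {k} + n × {k-1}   (for k = 0: τ - {0})
red : Type → ℕ → ℕ → Type
red []       k             n = []
red (c ∷ cs) zero          n = pred c ∷ cs
red (c ∷ cs) (suc zero)    n = (c + n) ∷ red cs zero n
red (c ∷ cs) (suc (suc k)) n = c ∷ red cs (suc k) n

N : (ℕ → ℕ) → ℕ → ℕ → ℕ
N f k t = k * (f t ∸ 1)

op : (ℕ → ℕ) → Type → ℕ → ℕ → Type
op f τ k t = red τ k (N f k t)

-- one-step reduction relation (contained in the multiset ordering)
Step : Type → Type → Set
Step σ τ = Σ ℕ λ k → Σ ℕ λ n → k ∈ᵀ τ × σ ≡ red τ k n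

mutual
  accCons : ∀ cs → Acc Step cs → ∀ c → Acc Step (c ∷ cs)
  accCons cs a c = acc (λ s → accStep cs a c s)

  accStep : ∀ cs → Acc Step cs → ∀ c {σ} → Step σ (c ∷ cs) → Acc Step σ
  accStep cs a (suc c) (zero , n , m , refl) = accCons cs a c
  accStep cs (acc rs) c (suc zero , n , m , refl) =
    accCons (red cs zero n) (rs (zero , n , m , refl)) (c + n)
  accStep cs (acc rs) c (suc (suc k) , n , m , refl) =
    accCons (red cs (suc k) n) (rs (suc k , n , m , refl)) c

stepWf : ∀ τ → Acc Step τ
stepWf []       = acc λ { (k , n , () , _) }
stepWf (c ∷ cs) = accCons cs (stepWf cs) c

-- max over the elements k ∈ τ of g k  (max ∅ = 0)
maxMem : (τ : Type) → ((k : ℕ) → k ∈ᵀ τ → ℕ) → ℕ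
maxMem []            g = 0
maxMem (zero ∷ cs)   g = maxMem cs (λ k m → g (suc k) m)
maxMem (suc c ∷ cs)  g = g zero (s≤s z≤n) ⊔ maxMem cs (λ k m → g (suc k) m)

M′ : (f : ℕ → ℕ) → (τ : Type) → Acc Step τ → ℕ → ℕ
M′ f τ (acc rs) t =
  maxMem τ (λ k m → suc (M′ f (op f τ k t) (rs (k , N f k t , m , refl)) (suc t)))

M : (ℕ → ℕ) → Type → ℕ → ℕ
M f τ t = M′ f τ (stepWf τ) t

module Submission where

-- Write  cf τ i  for the number of elements of τ that
-- are ≥ i, and say σ ≼ ρ ("ρ dominates σ") when  cf σ i ≤ cf ρ i  for every
-- i.  The proof rests on three facts about M (for any monotone f):
--   (1) M is monotone:  σ ≼ ρ  and  t ≤ t'  imply  M σ t ≤ M ρ t'.  Each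
--       move j of σ is answered by the move at the least element j' ≥ j
--       of ρ, and the two reducts are again dominated (induction on Acc).
--   (2) Exchange: for k < l in τ, reducing first at l (time t) and then at
--       k (time t+1) gives a type dominated by reducing first at k and then
--       at l.  This is the rearrangement inequality for N.
--   (3) Main lemma, by well-founded induction on τ: if k = min τ and l ∈ τ
--       then M τ_⟨l,t⟩ (t+1) ≤ M τ_⟨k,t⟩ (t+1).  Since k stays the minimum
--       of τ_⟨l,t⟩, by induction its best move is at k; then (2) and (1).
-- The theorem follows by unfolding the recursion defining M once.

open import Defs
open import Data.Nat using (ℕ; zero; suc; _<_; _≤_; _+_; _*_; _⊔_; z≤n; s≤s; s≤s⁻¹)
open import Data.Nat.Properties
open import Data.Nat.Tactic.RingSolver using (solve-∀)
open import Data.List using ([]; _∷_)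
open import Data.Product using (_×_; _,_; proj₁)
open import Data.Sum using (inj₁; inj₂)
open import Data.Empty using (⊥-elim)
open import Relation.Nullary using (Dec; yes; no)
open import Relation.Binary using (Tri; tri<; tri≈; tri>)
open import Relation.Binary.PropositionalEquality
open import Induction.WellFounded using (Acc; acc)

cf : Type → ℕ → ℕ
cf []       i       = 0
cf (c ∷ cs) zero    = c + cf cs zero
cf (c ∷ cs) (suc i) = cf cs i

_≼_ : Type → Type → Set
σ ≼ ρ = ∀ i → cf σ i ≤ cf ρ i

cf-split : ∀ τ j → cf τ j ≡ count τ j + cf τ (suc j)
cf-split []       j       = refl
cf-split (c ∷ cs) zero    = refl
cf-split (c ∷ cs) (suc j) = cf-split cs j

cf-antitone : ∀ τ {i i'} → i ≤ i' → cf τ i' ≤ cf τ i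
cf-antitone []       _                  = z≤n
cf-antitone (c ∷ cs) {zero} {zero}   _  = ≤-refl
cf-antitone (c ∷ cs) {zero} {suc i'} _  = ≤-trans (cf-antitone cs z≤n) (m≤n+m _ c)
cf-antitone (c ∷ cs) (s≤s le)           = cf-antitone cs le

cf-drop : ∀ τ j → j ∈ᵀ τ → suc (cf τ (suc j)) ≤ cf τ j
cf-drop τ j m = subst (suc (cf τ (suc j)) ≤_) (sym (cf-split τ j)) (+-monoˡ-≤ _ m)

cf-pos : ∀ τ j → j ∈ᵀ τ → 0 < cf τ j
cf-pos τ j j∈τ = ≤-trans (s≤s z≤n) (cf-drop τ j j∈τ)

cf-red-at : ∀ τ j n → j ∈ᵀ τ → suc (cf (red τ j n) j) ≡ cf τ j
cf-red-at (suc c ∷ cs) zero          n m = refl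
cf-red-at (c ∷ cs)     (suc zero)    n m = cf-red-at cs zero n m
cf-red-at (c ∷ cs)     (suc (suc j)) n m = cf-red-at cs (suc j) n m

cf-red-below : ∀ τ j n i → j ∈ᵀ τ → i < j → suc (cf (red τ j n) i) ≡ cf τ i + n
cf-red-below (c ∷ cs) (suc zero) n zero m _ =
  begin
    suc (c + n + cf (red cs zero n) zero)  ≡⟨ sym (+-suc (c + n) _) ⟩
    c + n + suc (cf (red cs zero n) zero)  ≡⟨ cong (c + n +_) (cf-red-at cs zero n m) ⟩
    c + n + cf cs zero                     ≡⟨ swap c n (cf cs zero) ⟩
    c + cf cs zero + n                     ∎
  where
  open ≡-Reasoning
  swap : ∀ a b x → a + b + x ≡ a + x + b
  swap = solve-∀
cf-red-below (c ∷ cs) (suc (suc j)) n zero m _ =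
  begin
    suc (c + cf (red cs (suc j) n) zero)  ≡⟨ sym (+-suc c _) ⟩
    c + suc (cf (red cs (suc j) n) zero)  ≡⟨ cong (c +_) (cf-red-below cs (suc j) n zero m (s≤s z≤n)) ⟩
    c + (cf cs zero + n)                  ≡⟨ sym (+-assoc c _ n) ⟩
    c + cf cs zero + n                    ∎
  where open ≡-Reasoning
cf-red-below (c ∷ cs) (suc zero) n (suc i) m (s≤s ())
cf-red-below (c ∷ cs) (suc (suc j)) n (suc i) m (s≤s i<j) = cf-red-below cs (suc j) n i m i<j

cf-red-above : ∀ τ j n i → j < i → cf (red τ j n) i ≡ cf τ i
cf-red-above []       _             _ _       _         = refl
cf-red-above (c ∷ cs) zero          n (suc i) _         = refl
cf-red-above (c ∷ cs) (suc zero)    n (suc i) (s≤s j<i) = cf-red-above cs zero n i j<i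
cf-red-above (c ∷ cs) (suc (suc j)) n (suc i) (s≤s j<i) = cf-red-above cs (suc j) n i j<i

cf-red-from : ∀ τ j n i → j ∈ᵀ τ → j ≤ i → suc (cf (red τ j n) i) ≤ cf τ j
cf-red-from τ j n i m j≤i with m≤n⇒m<n∨m≡n j≤i
... | inj₂ refl = ≤-reflexive (cf-red-at τ j n m)
... | inj₁ j<i  = begin
  suc (cf (red τ j n) i)  ≡⟨ cong suc (cf-red-above τ j n i j<i) ⟩
  suc (cf τ i)            ≤⟨ s≤s (cf-antitone τ j<i) ⟩
  suc (cf τ (suc j))      ≤⟨ cf-drop τ j m ⟩
  cf τ j                  ∎
  where open ≤-Reasoning

cf-red-upto : ∀ τ j n i → j ∈ᵀ τ → i ≤ j → cf τ i ≤ suc (cf (red τ j n) i)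
cf-red-upto τ j n i m i≤j with m≤n⇒m<n∨m≡n i≤j
... | inj₂ refl = ≤-reflexive (sym (cf-red-at τ j n m))
... | inj₁ i<j  = subst (cf τ i ≤_) (sym (cf-red-below τ j n i m i<j)) (m≤m+n _ n)

cf-red²-below : ∀ τ j₁ n₁ j₂ n₂ i → j₁ ∈ᵀ τ → j₂ ∈ᵀ red τ j₁ n₁ → i < j₁ → i < j₂ →
  suc (suc (cf (red (red τ j₁ n₁) j₂ n₂) i)) ≡ cf τ i + n₁ + n₂
cf-red²-below τ j₁ n₁ j₂ n₂ i m₁ m₂ i<j₁ i<j₂ =
  trans (cong suc (cf-red-below (red τ j₁ n₁) j₂ n₂ i m₂ i<j₂))
        (cong (_+ n₂) (cf-red-below τ j₁ n₁ i m₁ i<j₁))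

count-red-below : ∀ τ j n i → i < j → count τ i ≤ count (red τ j n) i
count-red-below []       j             n i       _         = z≤n
count-red-below (c ∷ cs) (suc zero)    n zero    _         = m≤m+n c n
count-red-below (c ∷ cs) (suc zero)    n (suc i) (s≤s ())
count-red-below (c ∷ cs) (suc (suc j)) n zero    _         = ≤-refl
count-red-below (c ∷ cs) (suc (suc j)) n (suc i) (s≤s i<j) = count-red-below cs (suc j) n i i<j

count-red-above : ∀ τ j n i → j < i → count (red τ j n) i ≡ count τ i
count-red-above []       _             _ _       _         = refl
count-red-above (c ∷ cs) zero          n (suc i) _         = refl
count-red-above (c ∷ cs) (suc zero)    n (suc i) (s≤s j<i) = count-red-above cs zero n i j<i
count-red-above (c ∷ cs) (suc (suc j)) n (suc i) (s≤s j<i) = count-red-above cs (suc j) n i j<i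

member-red-above : ∀ τ j n i → j < i → i ∈ᵀ τ → i ∈ᵀ red τ j n
member-red-above τ j n i j<i i∈τ = subst (0 <_) (sym (count-red-above τ j n i j<i)) i∈τ

count-red-other : ∀ τ j n i → suc i ≢ j → count (red τ j n) i ≤ count τ i
count-red-other []       j             n i       _  = z≤n
count-red-other (c ∷ cs) zero          n zero    _  = pred[n]≤n
count-red-other (c ∷ cs) zero          n (suc i) _  = ≤-refl
count-red-other (c ∷ cs) (suc zero)    n zero    ne = ⊥-elim (ne refl)
count-red-other (c ∷ cs) (suc zero)    n (suc i) _  = count-red-other cs zero n i (λ ())
count-red-other (c ∷ cs) (suc (suc j)) n zero    _  = ≤-refl
count-red-other (c ∷ cs) (suc (suc j)) n (suc i) ne =
  count-red-other cs (suc j) n i (λ e → ne (cong suc e))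

min-red : ∀ τ k l n → IsMin k τ → k < l → IsMin k (red τ l n)
min-red τ k l n (k∈τ , k-least) k<l =
  ≤-trans k∈τ (count-red-below τ l n k k<l) , least
  where
  least : ∀ j → j ∈ᵀ red τ l n → k ≤ j
  least j j∈ with suc j ≟ l
  ... | yes refl = s≤s⁻¹ k<l
  ... | no ne    = k-least j (≤-trans j∈ (count-red-other τ l n j ne))

record NextElement (ρ : Type) (j : ℕ) : Set where
  field
    elem   : ℕ
    above  : j ≤ elem
    member : elem ∈ᵀ ρ
    flat   : ∀ i → j ≤ i → i ≤ elem → cf ρ j ≤ cf ρ i

next-element : ∀ ρ j → 0 < cf ρ j → NextElement ρ j
next-element (suc c ∷ cs) zero _ = record
  { elem = zero ; above = z≤n ; member = s≤s z≤n ; flat = λ { zero _ _ → ≤-refl } }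
next-element (zero ∷ cs) zero h = record
  { elem = suc elem ; above = z≤n ; member = member
  ; flat = λ { zero _ _ → ≤-refl ; (suc i) _ (s≤s i≤e) → flat i z≤n i≤e } }
  where open NextElement (next-element cs zero h)
next-element (c ∷ cs) (suc j) h = record
  { elem = suc elem ; above = s≤s above ; member = member
  ; flat = λ { (suc i) (s≤s j≤i) (s≤s i≤e) → flat i j≤i i≤e } }
  where open NextElement (next-element cs j h)

red-≼ : ∀ σ ρ j n n' → σ ≼ ρ → j ∈ᵀ σ → (nx : NextElement ρ j) → n ≤ n' →
  red σ j n ≼ red ρ (NextElement.elem nx) n'
red-≼ σ ρ j n n' σ≼ρ j∈σ nx n≤n' i = by-region (i <? j) (i ≤? j')
  where
  open NextElement nx renaming (elem to j'; above to j≤j'; member to j'∈ρ)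
  open ≤-Reasoning

  below : i < j → cf (red σ j n) i ≤ cf (red ρ j' n') i
  below i<j = s≤s⁻¹ (begin
    suc (cf (red σ j n) i)    ≡⟨ cf-red-below σ j n i j∈σ i<j ⟩
    cf σ i + n                ≤⟨ +-mono-≤ (σ≼ρ i) n≤n' ⟩
    cf ρ i + n'               ≡⟨ sym (cf-red-below ρ j' n' i j'∈ρ (<-≤-trans i<j j≤j')) ⟩
    suc (cf (red ρ j' n') i)  ∎)

  between : j ≤ i → i ≤ j' → cf (red σ j n) i ≤ cf (red ρ j' n') i
  between j≤i i≤j' = s≤s⁻¹ (begin
    suc (cf (red σ j n) i)    ≤⟨ cf-red-from σ j n i j∈σ j≤i ⟩
    cf σ j                    ≤⟨ σ≼ρ j ⟩
    cf ρ j                    ≤⟨ flat i j≤i i≤j' ⟩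
    cf ρ i                    ≤⟨ cf-red-upto ρ j' n' i j'∈ρ i≤j' ⟩
    suc (cf (red ρ j' n') i)  ∎)

  beyond : j' < i → cf (red σ j n) i ≤ cf (red ρ j' n') i
  beyond j'<i = begin
    cf (red σ j n) i     ≡⟨ cf-red-above σ j n i (≤-<-trans j≤j' j'<i) ⟩
    cf σ i               ≤⟨ σ≼ρ i ⟩
    cf ρ i               ≡⟨ sym (cf-red-above ρ j' n' i j'<i) ⟩
    cf (red ρ j' n') i   ∎

  by-region : Dec (i < j) → Dec (i ≤ j') → cf (red σ j n) i ≤ cf (red ρ j' n') i
  by-region (yes i<j) _          = below i<j
  by-region (no i≮j)  (yes i≤j') = between (≮⇒≥ i≮j) i≤j'
  by-region (no _)    (no i≰j')  = beyond (≰⇒> i≰j')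

maxMem-cong : ∀ τ g h → (∀ k m → g k m ≡ h k m) → maxMem τ g ≡ maxMem τ h
maxMem-cong []           g h e = refl
maxMem-cong (zero ∷ cs)  g h e = maxMem-cong cs _ _ (λ k m → e (suc k) m)
maxMem-cong (suc c ∷ cs) g h e =
  cong₂ _⊔_ (e zero _) (maxMem-cong cs _ _ (λ k m → e (suc k) m))

maxMem-ub : ∀ τ g k (m : k ∈ᵀ τ) → g k m ≤ maxMem τ g
maxMem-ub (zero ∷ cs)  g (suc k) m         = maxMem-ub cs _ k m
maxMem-ub (suc c ∷ cs) g zero    (s≤s z≤n) = m≤m⊔n _ _
maxMem-ub (suc c ∷ cs) g (suc k) m         = ≤-trans (maxMem-ub cs _ k m) (m≤n⊔m _ _)

maxMem-lub : ∀ τ g B → (∀ k m → g k m ≤ B) → maxMem τ g ≤ B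
maxMem-lub []           g B h = z≤n
maxMem-lub (zero ∷ cs)  g B h = maxMem-lub cs _ B (λ k m → h (suc k) m)
maxMem-lub (suc c ∷ cs) g B h = ⊔-lub (h zero _) (maxMem-lub cs _ B (λ k m → h (suc k) m))

maxMem-empty : ∀ τ g → IsEmpty τ → maxMem τ g ≡ 0
maxMem-empty []           g E = refl
maxMem-empty (zero ∷ cs)  g E = maxMem-empty cs _ (λ k m → E (suc k) m)
maxMem-empty (suc c ∷ cs) g E = ⊥-elim (E zero (s≤s z≤n))

module _ (f : ℕ → ℕ) where

  M′-irrelevant : ∀ τ (a b : Acc Step τ) t → M′ f τ a t ≡ M′ f τ b t
  M′-irrelevant τ (acc rs) (acc rs') t =
    maxMem-cong τ _ _ (λ k m → cong suc (M′-irrelevant (op f τ k t) (rs _) (rs' _) (suc t)))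

  M′-unfold : ∀ τ (a : Acc Step τ) t →
    M′ f τ a t ≡ maxMem τ (λ j _ → suc (M f (op f τ j t) (suc t)))
  M′-unfold τ (acc rs) t =
    maxMem-cong τ _ _ (λ j m → cong suc (M′-irrelevant _ (rs _) (stepWf _) (suc t)))

  M-move : ∀ τ j t → j ∈ᵀ τ → suc (M f (op f τ j t) (suc t)) ≤ M f τ t
  M-move τ j t j∈τ = subst (suc (M f (op f τ j t) (suc t)) ≤_)
    (sym (M′-unfold τ (stepWf τ) t)) (maxMem-ub τ _ j j∈τ)

  M-lub : ∀ τ t B → (∀ j → j ∈ᵀ τ → suc (M f (op f τ j t) (suc t)) ≤ B) → M f τ t ≤ B
  M-lub τ t B h = subst (_≤ B) (sym (M′-unfold τ (stepWf τ) t)) (maxMem-lub τ _ B h)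

  M-empty : ∀ τ t → IsEmpty τ → M f τ t ≡ 0
  M-empty τ t E = trans (M′-unfold τ (stepWf τ) t) (maxMem-empty τ _ E)

rearrangement : ∀ {k l u v} → k ≤ l → u ≤ v → l * u + k * v ≤ k * u + l * v
rearrangement {k} {l} {u} k≤l u≤v with m≤n⇒∃[o]m+o≡n u≤v
... | w , refl = begin
  l * u + k * (u + w)    ≡⟨ split-left k l u w ⟩
  k * u + l * u + k * w  ≤⟨ +-monoʳ-≤ (k * u + l * u) (*-monoˡ-≤ w k≤l) ⟩
  k * u + l * u + l * w  ≡⟨ split-right k l u w ⟩
  k * u + l * (u + w)    ∎
  where
  open ≤-Reasoning
  split-left : ∀ k l u w → l * u + k * (u + w) ≡ k * u + l * u + k * w
  split-left = solve-∀
  split-right : ∀ k l u w → k * u + l * u + l * w ≡ k * u + l * (u + w)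
  split-right = solve-∀

module _ (f : ℕ → ℕ) (f-mono : ∀ {t t'} → t ≤ t' → f t ≤ f t') where

  N-mono : ∀ {j j' t t'} → j ≤ j' → t ≤ t' → N f j t ≤ N f j' t'
  N-mono j≤j' t≤t' = *-mono-≤ j≤j' (∸-monoˡ-≤ 1 (f-mono t≤t'))

  N-exchange : ∀ {k l} t → k ≤ l → N f l t + N f k (suc t) ≤ N f k t + N f l (suc t)
  N-exchange t k≤l = rearrangement k≤l (∸-monoˡ-≤ 1 (f-mono (n≤1+n t)))

  M′-mono : ∀ σ (a : Acc Step σ) ρ (b : Acc Step ρ) t t' → σ ≼ ρ → t ≤ t' →
    M′ f σ a t ≤ M′ f ρ b t'
  M′-mono σ (acc rs) ρ (acc rs') t t' σ≼ρ t≤t' = maxMem-lub σ _ _ answer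
    where
    answer : ∀ j (j∈σ : j ∈ᵀ σ) →
      suc (M′ f (op f σ j t) (rs (j , N f j t , j∈σ , refl)) (suc t)) ≤ M′ f ρ (acc rs') t'
    answer j j∈σ = ≤-trans
      (s≤s (M′-mono _ (rs _) _ (rs' (j' , N f j' t' , j'∈ρ , refl)) (suc t) (suc t')
             (red-≼ σ ρ j _ _ σ≼ρ j∈σ nx (N-mono j≤j' t≤t')) (s≤s t≤t')))
      (maxMem-ub ρ _ j' j'∈ρ)
      where
      nx : NextElement ρ j
      nx = next-element ρ j (≤-trans (cf-pos σ j j∈σ) (σ≼ρ j))
      open NextElement nx renaming (elem to j'; above to j≤j'; member to j'∈ρ)

  M-mono : ∀ σ ρ t t' → σ ≼ ρ → t ≤ t' → M f σ t ≤ M f ρ t'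
  M-mono σ ρ t t' = M′-mono σ (stepWf σ) ρ (stepWf ρ) t t'

  exchange : ∀ τ k l t → k ∈ᵀ τ → l ∈ᵀ τ → k < l →
    op f (op f τ l t) k (suc t) ≼ op f (op f τ k t) l (suc t)
  -- Checked threshold by threshold: below k the totals added differ by
  -- N-exchange; between k and l only the first move at l counts, which
  -- adds less at time t than at time t+1; from l on both sides agree.
  exchange τ k l t k∈τ l∈τ k<l i = by-region i (<-cmp i k) (<-cmp i l)
    where
    a b c d : ℕ
    a = N f l t
    b = N f k (suc t)
    c = N f k t
    d = N f l (suc t)
    τl τk : Type
    τl = red τ l a
    τk = red τ k c
    k∈τl : k ∈ᵀ τl
    k∈τl = ≤-trans k∈τ (count-red-below τ l a k k<l)
    l∈τk : l ∈ᵀ τk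
    l∈τk = member-red-above τ k c l k<l l∈τ
    a≤d : a ≤ d
    a≤d = N-mono {l} ≤-refl (n≤1+n t)
    open ≤-Reasoning

    below : ∀ i → i < k → cf (red τl k b) i ≤ cf (red τk l d) i
    below i i<k = s≤s⁻¹ (s≤s⁻¹ (begin
      suc (suc (cf (red τl k b) i))  ≡⟨ cf-red²-below τ l a k b i l∈τ k∈τl (<-trans i<k k<l) i<k ⟩
      cf τ i + a + b                 ≡⟨ +-assoc (cf τ i) a b ⟩
      cf τ i + (a + b)               ≤⟨ +-monoʳ-≤ (cf τ i) (N-exchange t (<⇒≤ k<l)) ⟩
      cf τ i + (c + d)               ≡⟨ sym (+-assoc (cf τ i) c d) ⟩
      cf τ i + c + d                 ≡⟨ sym (cf-red²-below τ k c l d i k∈τ l∈τk i<k (<-trans i<k k<l)) ⟩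
      suc (suc (cf (red τk l d) i))  ∎))

    at-k : cf (red τl k b) k ≤ cf (red τk l d) k
    at-k = s≤s⁻¹ (s≤s⁻¹ (begin
      suc (suc (cf (red τl k b) k))  ≡⟨ cong suc (cf-red-at τl k b k∈τl) ⟩
      suc (cf τl k)                  ≡⟨ cf-red-below τ l a k l∈τ k<l ⟩
      cf τ k + a                     ≤⟨ +-monoʳ-≤ (cf τ k) a≤d ⟩
      cf τ k + d                     ≡⟨ cong (_+ d) (sym (cf-red-at τ k c k∈τ)) ⟩
      suc (cf τk k + d)              ≡⟨ cong suc (sym (cf-red-below τk l d k l∈τk k<l)) ⟩
      suc (suc (cf (red τk l d) k))  ∎))

    middle : ∀ i → k < i → i < l → cf (red τl k b) i ≤ cf (red τk l d) i
    middle i k<i i<l = s≤s⁻¹ (begin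
      suc (cf (red τl k b) i)  ≡⟨ cong suc (cf-red-above τl k b i k<i) ⟩
      suc (cf τl i)            ≡⟨ cf-red-below τ l a i l∈τ i<l ⟩
      cf τ i + a               ≤⟨ +-monoʳ-≤ (cf τ i) a≤d ⟩
      cf τ i + d               ≡⟨ cong (_+ d) (sym (cf-red-above τ k c i k<i)) ⟩
      cf τk i + d              ≡⟨ sym (cf-red-below τk l d i l∈τk i<l) ⟩
      suc (cf (red τk l d) i)  ∎)

    at-l : cf (red τl k b) l ≤ cf (red τk l d) l
    at-l = s≤s⁻¹ (begin
      suc (cf (red τl k b) l)  ≡⟨ cong suc (cf-red-above τl k b l k<l) ⟩
      suc (cf τl l)            ≡⟨ cf-red-at τ l a l∈τ ⟩
      cf τ l                   ≡⟨ sym (cf-red-above τ k c l k<l) ⟩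
      cf τk l                  ≡⟨ sym (cf-red-at τk l d l∈τk) ⟩
      suc (cf (red τk l d) l)  ∎)

    beyond : ∀ i → l < i → cf (red τl k b) i ≤ cf (red τk l d) i
    beyond i l<i = begin
      cf (red τl k b) i  ≡⟨ cf-red-above τl k b i k<i ⟩
      cf τl i            ≡⟨ cf-red-above τ l a i l<i ⟩
      cf τ i             ≡⟨ sym (cf-red-above τ k c i k<i) ⟩
      cf τk i            ≡⟨ sym (cf-red-above τk l d i l<i) ⟩
      cf (red τk l d) i  ∎
      where k<i = <-trans k<l l<i

    by-region : ∀ i → Tri (i < k) (i ≡ k) (k < i) → Tri (i < l) (i ≡ l) (l < i) →
      cf (red τl k b) i ≤ cf (red τk l d) i
    by-region i (tri< i<k _ _) _              = below i i<k
    by-region _ (tri≈ _ refl _) _             = at-k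
    by-region i (tri> _ _ k<i) (tri< i<l _ _) = middle i k<i i<l
    by-region _ (tri> _ _ _)   (tri≈ _ refl _) = at-l
    by-region i (tri> _ _ _)   (tri> _ _ l<i) = beyond i l<i

  min-move-best : ∀ τ → Acc Step τ → ∀ k l t → IsMin k τ → l ∈ᵀ τ →
    M f (op f τ l t) (suc t) ≤ M f (op f τ k t) (suc t)
  min-move-best τ (acc rs) k l t (k∈τ , k-least) l∈τ with <-cmp k l
  ... | tri≈ _ refl _ = ≤-refl
  ... | tri> _ _ l<k  = ⊥-elim (<⇒≱ l<k (k-least l l∈τ))
  ... | tri< k<l _ _  = begin
    M f τl (suc t)                                   ≤⟨ M-lub f τl (suc t) _ best-in-τl ⟩
    suc (M f (op f τl k (suc t)) (suc (suc t)))      ≤⟨ s≤s (M-mono (op f τl k (suc t)) (op f τk l (suc t)) _ _ (exchange τ k l t k∈τ l∈τ k<l) ≤-refl) ⟩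
    suc (M f (op f τk l (suc t)) (suc (suc t)))      ≤⟨ M-move f τk l (suc t) (member-red-above τ k _ l k<l l∈τ) ⟩
    M f τk (suc t)                                   ∎
    where
    open ≤-Reasoning
    τl = op f τ l t
    τk = op f τ k t
    -- k is still the minimum of τl, so by induction its move is best there
    best-in-τl : ∀ j → j ∈ᵀ τl →
      suc (M f (op f τl j (suc t)) (suc (suc t))) ≤ suc (M f (op f τl k (suc t)) (suc (suc t)))
    best-in-τl j j∈τl = s≤s (min-move-best τl (rs (l , N f l t , l∈τ , refl)) k j (suc t)
                              (min-red τ k l _ (k∈τ , k-least) k<l) j∈τl)

strict⇒monotone : (f : ℕ → ℕ) → (∀ m n → m < n → f m < f n) → ∀ {t t'} → t ≤ t' → f t ≤ f t'
strict⇒monotone f f-strict t≤t' with m≤n⇒m<n∨m≡n t≤t'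
... | inj₁ t<t' = <⇒≤ (f-strict _ _ t<t')
... | inj₂ refl = ≤-refl

lemma1 : (f : ℕ → ℕ) → (∀ m n → m < n → f m < f n) → 0 < f 0 →
    ((τ : Type) (k l t : ℕ) → IsMin k τ → l ∈ᵀ τ →
        M f (op f τ l t) (suc t) ≤ M f (op f τ k t) (suc t))
    × ((τ : Type) (t : ℕ) → IsEmpty τ → M f τ t ≡ 0)
    × ((τ : Type) (k t : ℕ) → IsMin k τ →
        M f τ t ≡ suc (M f (op f τ k t) (suc t)))
lemma1 f f-strict _ = best , M-empty f , at-min
  where
  best : (τ : Type) (k l t : ℕ) → IsMin k τ → l ∈ᵀ τ →
    M f (op f τ l t) (suc t) ≤ M f (op f τ k t) (suc t)
  best τ = min-move-best f (strict⇒monotone f f-strict) τ (stepWf τ)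
  at-min : (τ : Type) (k t : ℕ) → IsMin k τ → M f τ t ≡ suc (M f (op f τ k t) (suc t))
  at-min τ k t k-min = ≤-antisym
    (M-lub f τ t _ (λ j j∈τ → s≤s (best τ k j t k-min j∈τ)))
    (M-move f τ k t (proj₁ k-min))
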